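{- Let $k\ge 1$ be an integer and $n=\lceil\log_2(k+1)\rceil+1$ (the minimum size of a set admitting a separating family of $k$ proper bipartitions). The number of separating families of $k$ proper bipartitions for an $n$-element set is $\binom{2^{\lceil\log_2(k+1)\rceil}-1}{k}$.
   Context: A bipartition of a set $S$ is a partition of $S$ into at most two nonempty components; it is proper if it has exactly two components. A bipartition cuts two elements if they lie in different components. A family of (distinct) bipartitions of $S$ is a separating family for $S$ if every two distinct elements of $S$ are cut by some bipartition in the family. -}

module Defs where

open import Data.Bool using (Bool; true; false; _∧_; _∨_; not; _xor_)
open import Data.Nat using (ℕ; zero; suc; _≡ᵇ_)
open import Data.Fin using (Fin)
open import Data.Fin.Properties using (_≟_)
open import Data.Fin.Subset using (Subset; ∣_∣)
open import Data.Vec using (Vec; []; _∷_; lookup)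
open import Data.List using (List; []; _∷_; map; _++_; filterᵇ; length; allFin)
open import Data.Bool.ListAction using (all; any)
open import Relation.Nullary.Decidable using (⌊_⌋)

allSubsets : ∀ n → List (Subset n)
allSubsets zero    = [] ∷ []
allSubsets (suc n) = map (false ∷_) (allSubsets n) ++ map (true ∷_) (allSubsets n)

isFull : ∀ {n} → Subset n → Bool
isFull []       = true
isFull (b ∷ bs) = b ∧ isFull bs

-- A proper bipartition {A, Fin n \ A} of Fin n is encoded by its component A
-- containing the element 0 (this picks a unique representative of the
-- unordered pair).  Both components are nonempty iff 0 ∈ A and A ≠ Fin n.
isProperBipartitionRep : ∀ {n} → Subset n → Bool
isProperBipartitionRep []       = false
isProperBipartitionRep (b ∷ bs) = b ∧ not (isFull (b ∷ bs))

properBipartitions : ∀ n → List (Subset n)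
properBipartitions n = filterᵇ isProperBipartitionRep (allSubsets n)

cuts : ∀ {n} → Subset n → Fin n → Fin n → Bool
cuts A x y = lookup A x xor lookup A y

isSeparating : ∀ {n} → List (Subset n) → Bool
isSeparating {n} F =
  all (λ x → all (λ y → ⌊ x ≟ y ⌋ ∨ any (λ A → cuts A x y) F) (allFin n)) (allFin n)

select : ∀ {A : Set} (l : List A) → Subset (length l) → List A
select []       []            = []
select (a ∷ l) (true  ∷ s)    = a ∷ select l s
select (a ∷ l) (false ∷ s)    = select l s

numSeparatingFamilies : ℕ → ℕ → ℕ
numSeparatingFamilies n k =
  length (filterᵇ
    (λ S → (∣ S ∣ ≡ᵇ k) ∧ isSeparating (select (properBipartitions n) S))
    (allSubsets (length (properBipartitions n))))

-- Let ⌈log₂ (k + 1)⌉ = m + 1, so that 2 ^ m ≤ k, and put n = m + 2. A proper bipartition of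
-- Fin n is determined by its block containing 0, a proper subset containing 0; there are
-- 2 ^ (n - 1) - 1 of them. For distinct x and y, those that do not cut x and y are the proper
-- subsets containing 0 on which x and y agree: 2 ^ (n - 2) - 1 = 2 ^ m - 1 < k of them. Hence
-- every family of k proper bipartitions cuts every pair, i.e. is separating, and the count is
-- the number of k-subsets of the 2 ^ (m + 1) - 1 proper bipartitions.
module Submission where

open import Defs
open import Data.Bool using (Bool; true; false; _∧_; _∨_; not; _xor_; T)
open import Data.Bool.Properties using (xor-assoc; xor-comm)
open import Data.Bool.ListAction using (all; any)
open import Data.Fin using (Fin; zero; suc)
open import Data.Fin.Properties using (_≟_)
open import Data.Fin.Subset using (Subset; ∣_∣; ⊤)
open import Data.List using (List; []; _∷_; map; _++_; filterᵇ; length; allFin)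
open import Data.List.Properties using (length-++; filter-++)
open import Data.Nat using (ℕ; zero; suc; _+_; _∸_; _^_; _≤_; _<_; _≥_; _≡ᵇ_; z≤n; s≤s)
open import Data.Nat.Combinatorics using (_C_; nCk+nC[k+1]≡[n+1]C[k+1])
open import Data.Nat.Logarithm using (⌈log₂_⌉; ⌈log₂⌉-mono-≤; ⌈log₂2^n⌉≡n)
open import Data.Nat.Properties
  using ( +-comm; +-suc; +-identityʳ; ≤-trans; ≤-pred; n≤1+n; <-irrefl; ≰⇒>; _≤?_; ∸-monoʳ-<
        ; m^n>0; ≡ᵇ⇒≡; module ≤-Reasoning)
open import Data.Product using (∃-syntax; _×_; _,_)
open import Data.Vec using ([]; _∷_; lookup)
open import Data.Vec.Properties using (lookup-replicate)
open import Relation.Binary.PropositionalEquality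
  using (_≡_; _≢_; refl; sym; trans; cong; cong₂; subst; module ≡-Reasoning)
open import Relation.Nullary using (yes; no; contradiction)
open import Relation.Nullary.Decidable using (⌊_⌋)

private
  variable
    A B : Set

countᵇ : (A → Bool) → List A → ℕ
countᵇ p xs = length (filterᵇ p xs)

countᵇ-++ : ∀ (p : A → Bool) xs ys → countᵇ p (xs ++ ys) ≡ countᵇ p xs + countᵇ p ys
countᵇ-++ p xs ys = trans (cong length (filter-++ _ xs ys)) (length-++ (filterᵇ p xs))

countᵇ-map : ∀ (p : B → Bool) (f : A → B) xs → countᵇ p (map f xs) ≡ countᵇ (λ a → p (f a)) xs
countᵇ-map p f []       = refl
countᵇ-map p f (x ∷ xs) with p (f x)
... | true  = cong suc (countᵇ-map p f xs)
... | false = countᵇ-map p f xs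

countᵇ-cong : ∀ {p q : A → Bool} → (∀ a → p a ≡ q a) → ∀ xs → countᵇ p xs ≡ countᵇ q xs
countᵇ-cong         p≗q []       = refl
countᵇ-cong {q = q} p≗q (x ∷ xs) rewrite p≗q x with q x
... | true  = cong suc (countᵇ-cong p≗q xs)
... | false = countᵇ-cong p≗q xs

countᵇ-filterᵇ : ∀ (p q : A → Bool) xs → countᵇ q (filterᵇ p xs) ≡ countᵇ (λ a → p a ∧ q a) xs
countᵇ-filterᵇ p q []       = refl
countᵇ-filterᵇ p q (x ∷ xs) with p x
... | false = countᵇ-filterᵇ p q xs
... | true with q x
...   | true  = cong suc (countᵇ-filterᵇ p q xs)
...   | false = countᵇ-filterᵇ p q xs

countᵇ-split : ∀ (q p : A → Bool) xs →
  countᵇ p xs ≡ countᵇ (λ a → q a ∧ p a) xs + countᵇ (λ a → not (q a) ∧ p a) xs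
countᵇ-split q p []       = refl
countᵇ-split q p (x ∷ xs) with p x | q x
... | true  | true  = cong suc (countᵇ-split q p xs)
... | true  | false = trans (cong suc (countᵇ-split q p xs)) (sym (+-suc _ _))
... | false | true  = countᵇ-split q p xs
... | false | false = countᵇ-split q p xs

countᵇ-true : ∀ (xs : List A) → countᵇ (λ _ → true) xs ≡ length xs
countᵇ-true []       = refl
countᵇ-true (x ∷ xs) = cong suc (countᵇ-true xs)

countᵇ-false : ∀ (xs : List A) → countᵇ (λ _ → false) xs ≡ 0
countᵇ-false []       = refl
countᵇ-false (x ∷ xs) = countᵇ-false xs

#subsets : ∀ n → (Subset n → Bool) → ℕ
#subsets n p = countᵇ p (allSubsets n)

#subsets-suc : ∀ n (p : Subset (suc n) → Bool) →
  #subsets (suc n) p ≡ #subsets n (λ s → p (false ∷ s)) + #subsets n (λ s → p (true ∷ s))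
#subsets-suc n p = trans (countᵇ-++ p (map (false ∷_) (allSubsets n)) _)
  (cong₂ _+_ (countᵇ-map p (false ∷_) (allSubsets n)) (countᵇ-map p (true ∷_) (allSubsets n)))

#subsets-cong : ∀ n {p q : Subset n → Bool} → (∀ s → p s ≡ q s) → #subsets n p ≡ #subsets n q
#subsets-cong n p≗q = countᵇ-cong p≗q (allSubsets n)

#subsets-false : ∀ n → #subsets n (λ _ → false) ≡ 0
#subsets-false n = countᵇ-false (allSubsets n)

2^n+2^n≡2^[1+n] : ∀ n → 2 ^ n + 2 ^ n ≡ 2 ^ suc n
2^n+2^n≡2^[1+n] n = cong (2 ^ n +_) (sym (+-identityʳ _))

#subsets-true : ∀ n → #subsets n (λ _ → true) ≡ 2 ^ n
#subsets-true zero    = refl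
#subsets-true (suc n) = begin
  #subsets (suc n) (λ _ → true)                     ≡⟨ #subsets-suc n _ ⟩
  #subsets n (λ _ → true) + #subsets n (λ _ → true) ≡⟨ cong₂ _+_ (#subsets-true n) (#subsets-true n) ⟩
  2 ^ n + 2 ^ n                                     ≡⟨ 2^n+2^n≡2^[1+n] n ⟩
  2 ^ suc n                                         ∎
  where open ≡-Reasoning

#subsets-size : ∀ n k → #subsets n (λ s → ∣ s ∣ ≡ᵇ k) ≡ n C k
#subsets-size zero    zero    = refl
#subsets-size zero    (suc k) = refl
#subsets-size (suc n) zero    = trans (#subsets-suc n _) (cong₂ _+_ (#subsets-size n 0) (#subsets-false n))
#subsets-size (suc n) (suc k) = begin
  #subsets (suc n) (λ s → ∣ s ∣ ≡ᵇ suc k)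
    ≡⟨ #subsets-suc n _ ⟩
  #subsets n (λ s → ∣ s ∣ ≡ᵇ suc k) + #subsets n (λ s → ∣ s ∣ ≡ᵇ k)
    ≡⟨ cong₂ _+_ (#subsets-size n (suc k)) (#subsets-size n k) ⟩
  n C suc k + n C k
    ≡⟨ +-comm (n C suc k) (n C k) ⟩
  n C k + n C suc k
    ≡⟨ nCk+nC[k+1]≡[n+1]C[k+1] n k ⟩
  suc n C suc k
    ∎
  where open ≡-Reasoning

#subsets-isFull : ∀ n (p : Subset n → Bool) → p ⊤ ≡ true → #subsets n (λ s → isFull s ∧ p s) ≡ 1
#subsets-isFull zero    p p⊤ rewrite p⊤ = refl
#subsets-isFull (suc n) p p⊤ =
  trans (#subsets-suc n _) (cong₂ _+_ (#subsets-false n) (#subsets-isFull n (λ s → p (true ∷ s)) p⊤))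

#subsets-nonFull : ∀ n (p : Subset n → Bool) → p ⊤ ≡ true →
  #subsets n (λ s → not (isFull s) ∧ p s) ≡ #subsets n p ∸ 1
#subsets-nonFull n p p⊤ = sym (begin
  #subsets n p ∸ 1
    ≡⟨ cong (_∸ 1) (countᵇ-split isFull p (allSubsets n)) ⟩
  #subsets n (λ s → isFull s ∧ p s) + #subsets n (λ s → not (isFull s) ∧ p s) ∸ 1
    ≡⟨ cong (λ c → c + #subsets n (λ s → not (isFull s) ∧ p s) ∸ 1) (#subsets-isFull n p p⊤) ⟩
  #subsets n (λ s → not (isFull s) ∧ p s)
    ∎)
  where open ≡-Reasoning

#subsets-xor-lookup : ∀ m b (i : Fin (suc m)) → #subsets (suc m) (λ s → b xor lookup s i) ≡ 2 ^ m
#subsets-xor-lookup m false zero =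
  trans (#subsets-suc m _) (cong₂ _+_ (#subsets-false m) (#subsets-true m))
#subsets-xor-lookup m true zero =
  trans (#subsets-suc m _) (trans (cong₂ _+_ (#subsets-true m) (#subsets-false m)) (+-identityʳ _))
#subsets-xor-lookup (suc m) b (suc i) = trans (#subsets-suc (suc m) _)
  (trans (cong₂ _+_ (#subsets-xor-lookup m b i) (#subsets-xor-lookup m b i))
         (2^n+2^n≡2^[1+n] m))

-- The prefix c is arbitrary so that the induction on i and j goes through; it is true for the
-- representatives of proper bipartitions.
#subsets-xor-lookup₂ : ∀ m b c (i j : Fin (suc (suc m))) → i ≢ j →
  #subsets (suc m) (λ s → b xor (lookup (c ∷ s) i xor lookup (c ∷ s) j)) ≡ 2 ^ m
#subsets-xor-lookup₂ m b c zero zero i≢j = contradiction refl i≢j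
#subsets-xor-lookup₂ m b c zero (suc j) _ =
  trans (#subsets-cong (suc m) (λ s → sym (xor-assoc b c (lookup s j)))) (#subsets-xor-lookup m (b xor c) j)
#subsets-xor-lookup₂ m b c (suc i) zero _ =
  trans (#subsets-cong (suc m) λ s →
           trans (cong (b xor_) (xor-comm (lookup s i) c)) (sym (xor-assoc b c (lookup s i))))
        (#subsets-xor-lookup m (b xor c) i)
#subsets-xor-lookup₂ zero    b c (suc zero) (suc zero) i≢j = contradiction refl i≢j
#subsets-xor-lookup₂ (suc m) b c (suc i) (suc j) i≢j = trans (#subsets-suc (suc m) _)
  (trans (cong₂ _+_ (#subsets-xor-lookup₂ m b false i j i≢j′) (#subsets-xor-lookup₂ m b true i j i≢j′))
         (2^n+2^n≡2^[1+n] m))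
  where i≢j′ = λ i≡j → i≢j (cong suc i≡j)

countᵇ-properBipartitions : ∀ n (q : Subset (suc n) → Bool) → q ⊤ ≡ true →
  countᵇ q (properBipartitions (suc n)) ≡ #subsets n (λ s → q (true ∷ s)) ∸ 1
countᵇ-properBipartitions n q q⊤ = begin
  countᵇ q (properBipartitions (suc n))
    ≡⟨ countᵇ-filterᵇ isProperBipartitionRep q (allSubsets (suc n)) ⟩
  #subsets (suc n) (λ s → isProperBipartitionRep s ∧ q s)
    ≡⟨ #subsets-suc n _ ⟩
  #subsets n (λ _ → false) + #subsets n (λ s → not (isFull s) ∧ q (true ∷ s))
    ≡⟨ cong₂ _+_ (#subsets-false n) (#subsets-nonFull n (λ s → q (true ∷ s)) q⊤) ⟩
  #subsets n (λ s → q (true ∷ s)) ∸ 1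
    ∎
  where open ≡-Reasoning

length-properBipartitions : ∀ n → length (properBipartitions (suc n)) ≡ 2 ^ n ∸ 1
length-properBipartitions n = begin
  length (properBipartitions (suc n))              ≡⟨ countᵇ-true (properBipartitions (suc n)) ⟨
  countᵇ (λ _ → true) (properBipartitions (suc n)) ≡⟨ countᵇ-properBipartitions n _ refl ⟩
  #subsets n (λ _ → true) ∸ 1                      ≡⟨ cong (_∸ 1) (#subsets-true n) ⟩
  2 ^ n ∸ 1                                        ∎
  where open ≡-Reasoning

cuts-⊤ : ∀ {n} (x y : Fin n) → cuts ⊤ x y ≡ false
cuts-⊤ x y rewrite lookup-replicate x true | lookup-replicate y true = refl

countᵇ-notCutting : ∀ m (x y : Fin (suc (suc m))) → x ≢ y →
  countᵇ (λ A → not (cuts A x y)) (properBipartitions (suc (suc m))) ≡ 2 ^ m ∸ 1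
countᵇ-notCutting m x y x≢y =
  trans (countᵇ-properBipartitions (suc m) _ (cong not (cuts-⊤ x y)))
        (cong (_∸ 1) (#subsets-xor-lookup₂ m true true x y x≢y))

any-select : ∀ (f : A → Bool) l (S : Subset (length l)) →
  countᵇ (λ a → not (f a)) l < ∣ S ∣ → any f (select l S) ≡ true
any-select f []      []          ()
any-select f (a ∷ l) (false ∷ S) lt with f a
... | true  = any-select f l S lt
... | false = any-select f l S (≤-trans (n≤1+n _) lt)
any-select f (a ∷ l) (true ∷ S) lt with f a
... | true  = refl
... | false = any-select f l S (≤-pred lt)

all-true : ∀ (f : A → Bool) xs → (∀ a → f a ≡ true) → all f xs ≡ true
all-true f []       _  = refl
all-true f (x ∷ xs) f≡true rewrite f≡true x = all-true f xs f≡true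

isSeparating-select : ∀ {n} (l : List (Subset n)) (S : Subset (length l)) →
  (∀ x y → x ≢ y → countᵇ (λ A → not (cuts A x y)) l < ∣ S ∣) →
  isSeparating (select l S) ≡ true
isSeparating-select {n} l S few =
  all-true _ (allFin n) λ x → all-true _ (allFin n) λ y → separated x y
  where
    separated : ∀ x y → (⌊ x ≟ y ⌋ ∨ any (λ A → cuts A x y) (select l S)) ≡ true
    separated x y with x ≟ y
    ... | yes _   = refl
    ... | no x≢y = any-select (λ A → cuts A x y) l S (few x y x≢y)

numSeparatingFamilies-allSeparating : ∀ n k →
  (∀ S → ∣ S ∣ ≡ k → isSeparating (select (properBipartitions n) S) ≡ true) →
  numSeparatingFamilies n k ≡ length (properBipartitions n) C k
numSeparatingFamilies-allSeparating n k sep =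
  trans (#subsets-cong (length (properBipartitions n)) separatingIfSizeK) (#subsets-size _ k)
  where
    separatingIfSizeK : ∀ S →
      ((∣ S ∣ ≡ᵇ k) ∧ isSeparating (select (properBipartitions n) S)) ≡ (∣ S ∣ ≡ᵇ k)
    separatingIfSizeK S with ∣ S ∣ ≡ᵇ k in eq
    ... | false = refl
    ... | true  = sep S (≡ᵇ⇒≡ ∣ S ∣ k (subst T (sym eq) _))

numSeparatingFamilies-large : ∀ m k → 2 ^ m ≤ k →
  numSeparatingFamilies (suc (suc m)) k ≡ (2 ^ suc m ∸ 1) C k
numSeparatingFamilies-large m k 2^m≤k =
  trans (numSeparatingFamilies-allSeparating (suc (suc m)) k
           (λ S ∣S∣≡k → isSeparating-select (properBipartitions (suc (suc m))) S (fewNotCutting S ∣S∣≡k)))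
        (cong (_C k) (length-properBipartitions (suc m)))
  where
    fewNotCutting : ∀ S → ∣ S ∣ ≡ k → ∀ x y → x ≢ y →
      countᵇ (λ A → not (cuts A x y)) (properBipartitions (suc (suc m))) < ∣ S ∣
    fewNotCutting S ∣S∣≡k x y x≢y rewrite countᵇ-notCutting m x y x≢y | ∣S∣≡k =
      ≤-trans (∸-monoʳ-< {o = 0} (s≤s z≤n) (m^n>0 2 m)) 2^m≤k

⌈log₂⌉≡suc-2^< : ∀ n → 2 ≤ n → ∃[ m ] ⌈log₂ n ⌉ ≡ suc m × 2 ^ m < n
⌈log₂⌉≡suc-2^< n 2≤n with ⌈log₂ n ⌉ in eq
... | zero  = contradiction (subst (1 ≤_) eq (⌈log₂⌉-mono-≤ 2≤n)) λ ()
... | suc m with n ≤? 2 ^ m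
...   | no n≰2^m  = m , refl , ≰⇒> n≰2^m
...   | yes n≤2^m = contradiction (begin
  suc m           ≡⟨ eq ⟨
  ⌈log₂ n ⌉       ≤⟨ ⌈log₂⌉-mono-≤ n≤2^m ⟩
  ⌈log₂ 2 ^ m ⌉   ≡⟨ ⌈log₂2^n⌉≡n m ⟩
  m               ∎) (<-irrefl refl)
  where open ≤-Reasoning

proposition3p20 : (k : ℕ) → k ≥ 1 →
    numSeparatingFamilies (⌈log₂ (k + 1) ⌉ + 1) k ≡ (2 ^ ⌈log₂ (k + 1) ⌉ ∸ 1) C k
proposition3p20 k k≥1
  with m , eq , 2^m<k+1 ← ⌈log₂⌉≡suc-2^< (k + 1) (subst (2 ≤_) (+-comm 1 k) (s≤s k≥1))
  rewrite eq | +-comm m 1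
  = numSeparatingFamilies-large m k (≤-pred (subst (2 ^ m <_) (+-comm k 1) 2^m<k+1))
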